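{- Let $n \geq 4$ be an integer, let $m = \lfloor n/4 \rfloor$ and $\bar r = n \bmod 4$. Then the mixed domination number of the generalized Petersen graph $P(n,2)$ is $$\gamma_{md}(P(n,2)) = \begin{cases} 3m & \text{if } \bar r = 0,\\ 3m+1 & \text{if } \bar r = 1,\\ 3m+2 & \text{if } \bar r = 2,\\ 3m+3 & \text{if } \bar r = 3.\end{cases}$$
   Context: For integers $n$ and $k$ with $1 \le k \le n/2$, the generalized Petersen graph $P(n,k)$ has vertex set $\{v_i, u_i : 0 \le i \le n-1\}$ and edge set $\{v_i v_{(i+1) \bmod n},\ v_i u_i,\ u_i u_{(i+k) \bmod n} : 0 \le i \le n-1\}$. For a graph $G=(V,E)$, a set $S \subseteq V \cup E$ is a mixed dominating set if every element of $(V \cup E)\setminus S$ is adjacent or incident to some element of $S$ (vertices are adjacent if joined by an edge, edges are adjacent if they share an endpoint, and a vertex and an edge are incident if the vertex is an endpoint of the edge). The mixed domination number $\gamma_{md}(G)$ is the minimum size of a mixed dominating set of $G$. -}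

module Defs where

open import Data.Nat using (ℕ; NonZero; _+_; _≤_; _%_)
open import Data.Nat.DivMod using (m%n<n)
open import Data.Fin using (Fin; toℕ; fromℕ<)
open import Data.Sum using (_⊎_; inj₁; inj₂)
open import Data.Empty using (⊥)
open import Data.Product using (Σ; _×_; _,_; ∃; ∃-syntax)
open import Data.List using (List; length)
open import Data.List.Relation.Unary.Any using (Any)
open import Relation.Binary.PropositionalEquality using (_≡_)

module MixedDomination (V : Set) (Adj : V → V → Set) where

  -- an edge is an (ordered) pair of adjacent vertices; two such pairs
  -- represent the same edge iff they have the same endpoint set
  Edge : Set
  Edge = Σ V λ x → Σ V λ y → Adj x y

  src tgt : Edge → V
  src (x , _ , _) = x
  tgt (_ , y , _) = y

  Incident : V → Edge → Set
  Incident a e = (a ≡ src e) ⊎ (a ≡ tgt e)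

  SameEdge : Edge → Edge → Set
  SameEdge e f = ((src e ≡ src f) × (tgt e ≡ tgt f))
               ⊎ ((src e ≡ tgt f) × (tgt e ≡ src f))

  Elem : Set
  Elem = V ⊎ Edge


  SameElem : Elem → Elem → Set
  SameElem (inj₁ a) (inj₁ b) = a ≡ b
  SameElem (inj₁ _) (inj₂ _) = ⊥
  SameElem (inj₂ _) (inj₁ _) = ⊥
  SameElem (inj₂ e) (inj₂ f) = SameEdge e f

  AdjOrInc : Elem → Elem → Set
  AdjOrInc (inj₁ a) (inj₁ b) = Adj a b
  AdjOrInc (inj₁ a) (inj₂ f) = Incident a f
  AdjOrInc (inj₂ e) (inj₁ b) = Incident b e
  AdjOrInc (inj₂ e) (inj₂ f) = ∃[ a ] (Incident a e × Incident a f)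

  IsMixedDominating : List Elem → Set
  IsMixedDominating S =
    ∀ (x : Elem) → Any (SameElem x) S ⊎ Any (AdjOrInc x) S

  MixedDominationNumber : ℕ → Set
  MixedDominationNumber d =
    (Σ (List Elem) λ S → IsMixedDominating S × length S ≡ d)
    × (∀ (S : List Elem) → IsMixedDominating S → d ≤ length S)

data Vtx (n : ℕ) : Set where
  v : Fin n → Vtx n
  u : Fin n → Vtx n

plus : ∀ {n} .{{_ : NonZero n}} → Fin n → ℕ → Fin n
plus {n} i j = fromℕ< (m%n<n (toℕ i + j) n)

data PEdge (n k : ℕ) .{{_ : NonZero n}} : Vtx n → Vtx n → Set where
  rim   : ∀ i → PEdge n k (v i) (v (plus i 1))
  spoke : ∀ i → PEdge n k (v i) (u i)
  inner : ∀ i → PEdge n k (u i) (u (plus i k))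

PAdj : (n k : ℕ) .{{_ : NonZero n}} → Vtx n → Vtx n → Set
PAdj n k x y = PEdge n k x y ⊎ PEdge n k y x

module Submission where

open import Defs
open import Data.Nat using (ℕ; NonZero; _≤_; _+_; _*_; _/_; _%_)
open import Data.Nat using (zero; suc; _<_; _∸_; _≤ᵇ_; _≤?_; _≟_; z≤n; s≤s)
open import Data.Nat.Properties
open import Data.Nat.DivMod
  using (m%n<n; m/n≡0⇒m<n; m<n⇒m%n≡m; [m+n]%n≡m%n; %-distribˡ-+; m%n%n≡m%n; m≡m%n+[m/n]*n)
open import Data.Nat.Tactic.RingSolver using (solve-∀)
open import Algebra.Properties.CommutativeSemigroup +-commutativeSemigroup
  using (interchange; xy∙z≈xz∙y)
open import Data.Bool using (Bool; true; false; _∧_; _∨_; T; if_then_else_)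
open import Data.Bool.Properties using (T-∧; T-∨; ∧-conicalˡ; ∧-conicalʳ)
open import Data.Empty using (⊥-elim)
open import Data.Unit using (tt)
open import Data.Sum using (_⊎_; inj₁; inj₂)
import Data.Sum as Sum
open import Data.Product using (_×_; _,_; ∃-syntax; proj₁; proj₂)
open import Data.Fin using (Fin; toℕ; fromℕ<)
import Data.Fin.Properties as Fin
open import Data.Fin.Properties using (toℕ-injective; toℕ-fromℕ<; toℕ<n)
open import Data.List using (List; []; _∷_; length; _++_; take)
open import Data.List.Properties using (length-++; length-take)
open import Data.List.Membership.Propositional using (_∈_; lose)
open import Data.List.Membership.Propositional.Properties using (∈-++⁺ˡ; ∈-++⁺ʳ)
open import Data.List.Relation.Unary.Any using (Any; here; there; any?)
import Data.List.Relation.Unary.Any as Any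
open import Data.List.Relation.Unary.Any.Properties using (Any-⊎⁻)
open import Function using (_∘_)
open import Function.Bundles using (Equivalence)
open import Level using (0ℓ)
open import Relation.Nullary using (¬_; Dec; yes; no; does; _⊎-dec_)
import Relation.Nullary.Decidable as Dec
open import Relation.Nullary.Decidable using (dec-false)
open import Relation.Unary using (Pred; Decidable)
open import Relation.Binary.Definitions using (DecidableEquality; tri<; tri≈; tri>)
open import Relation.Binary.PropositionalEquality

-- Call a vertex chosen if it is an element of S, covered if it is an element of S or an
-- endpoint of an edge in S, and uncovered otherwise; let A and I count the chosen and the
-- uncovered vertices. Each element of S accounts for at most two of the incidences
-- "x is chosen" and "x is covered", so A + (2n - I) ≤ 2|S|. Domination means that no edge
-- joins two uncovered vertices and every uncovered vertex has a chosen neighbour. Reading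
-- P(n,2) as a cycle of columns {v_j, u_j}, these constraints only involve five consecutive
-- columns, and a potential on four columns (checked exhaustively on all 3^10 label windows)
-- turns them into 2 uncovered(j) + Φ(j+1) ≤ 1 + 2 chosen(j) + Φ(j); summing around the
-- cycle gives 2I ≤ n + 2A, hence 3n ≤ 4|S|, i.e. |S| ≥ 3⌊n/4⌋ + (n mod 4).
-- Conversely, each block of four columns is dominated by the spoke v_{4q}u_{4q}, the inner
-- edge u_{4q+1}u_{4q+3} and the vertex v_{4q+2}, and the n mod 4 remaining columns by the
-- spoke v_{4m}u_{4m} and the vertices v_{4m+1}, v_{4m+2} (as far as they exist), m = ⌊n/4⌋.

∑< : ℕ → (ℕ → ℕ) → ℕ
∑< zero    f = 0
∑< (suc N) f = ∑< N f + f N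

∑<-mono : ∀ N {f g} → (∀ j → j < N → f j ≤ g j) → ∑< N f ≤ ∑< N g
∑<-mono zero    f≤g = z≤n
∑<-mono (suc N) f≤g = +-mono-≤ (∑<-mono N λ j j<N → f≤g j (m<n⇒m<1+n j<N)) (f≤g N ≤-refl)

∑<-+ : ∀ N f g → ∑< N (λ j → f j + g j) ≡ ∑< N f + ∑< N g
∑<-+ zero    f g = refl
∑<-+ (suc N) f g rewrite ∑<-+ N f g = interchange (∑< N f) (∑< N g) (f N) (g N)

∑<-cong : ∀ N {f g} → (∀ j → f j ≡ g j) → ∑< N f ≡ ∑< N g
∑<-cong zero    f≡g = refl
∑<-cong (suc N) f≡g = cong₂ _+_ (∑<-cong N f≡g) (f≡g N)

∑<-const : ∀ N k → ∑< N (λ _ → k) ≡ N * k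
∑<-const zero    k = refl
∑<-const (suc N) k rewrite ∑<-const N k = +-comm (N * k) k

∑<-*ˡ : ∀ N k f → ∑< N (λ j → k * f j) ≡ k * ∑< N f
∑<-*ˡ zero    k f = sym (*-zeroʳ k)
∑<-*ˡ (suc N) k f rewrite ∑<-*ˡ N k f = sym (*-distribˡ-+ k (∑< N f) (f N))

∑<-rotate : ∀ N f → f N ≡ f 0 → ∑< N (λ j → f (suc j)) ≡ ∑< N f
∑<-rotate N f fN≡f0 = +-cancelʳ-≡ (f 0) _ _ (begin
  ∑< N (λ j → f (suc j)) + f 0 ≡⟨ shift N ⟩
  ∑< N f + f N                 ≡⟨ cong (∑< N f +_) fN≡f0 ⟩
  ∑< N f + f 0                 ∎)
  where
  open ≡-Reasoning
  shift : ∀ N → ∑< N (λ j → f (suc j)) + f 0 ≡ ∑< N f + f N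
  shift zero    = refl
  shift (suc N) = begin
    ∑< N (λ j → f (suc j)) + f (suc N) + f 0  ≡⟨ xy∙z≈xz∙y (∑< N (λ j → f (suc j))) _ _ ⟩
    ∑< N (λ j → f (suc j)) + f 0 + f (suc N)  ≡⟨ cong (_+ f (suc N)) (shift N) ⟩
    ∑< N f + f N + f (suc N)                  ∎

𝟙 : Bool → ℕ
𝟙 true  = 1
𝟙 false = 0

𝟙-∨ : ∀ a b → 𝟙 (a ∨ b) ≤ 𝟙 a + 𝟙 b
𝟙-∨ true  b = s≤s z≤n
𝟙-∨ false b = ≤-refl

module _ {P : Pred ℕ 0ℓ} (P? : Decidable P) where

  ∑<-𝟙-none : ∀ N → (∀ j → j < N → ¬ P j) → ∑< N (λ j → 𝟙 (does (P? j))) ≡ 0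
  ∑<-𝟙-none zero    _  = refl
  ∑<-𝟙-none (suc N) ¬P rewrite ∑<-𝟙-none N (λ j j<N → ¬P j (m<n⇒m<1+n j<N))
                             | dec-false (P? N) (¬P N ≤-refl) = refl

  ∑<-𝟙-unique : ∀ N → (∀ {j k} → j < N → k < N → P j → P k → j ≡ k) →
                ∑< N (λ j → 𝟙 (does (P? j))) ≤ 1
  ∑<-𝟙-unique zero    _      = z≤n
  ∑<-𝟙-unique (suc N) unique with P? N
  ... | yes PN = ≤-reflexive (cong (_+ 1) (∑<-𝟙-none N λ j j<N Pj →
                   <-irrefl (unique (m<n⇒m<1+n j<N) ≤-refl Pj PN) j<N))
  ... | no  _  = ≤-trans (≤-reflexive (+-identityʳ _))
                   (∑<-𝟙-unique N λ j<N k<N → unique (m<n⇒m<1+n j<N) (m<n⇒m<1+n k<N))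

3n≤4L : ∀ n I A L → 2 * I ≤ n + 2 * A → A + n * 2 ≤ I + 2 * L → 3 * n ≤ 4 * L
3n≤4L n I A L 2I≤n+2A A+2n≤I+2L = +-cancelˡ-≤ (n + 2 * A) _ _ (begin
  n + 2 * A + 3 * n  ≡⟨ e₁ n A ⟩
  2 * (A + n * 2)    ≤⟨ *-monoʳ-≤ 2 A+2n≤I+2L ⟩
  2 * (I + 2 * L)    ≡⟨ e₂ I L ⟩
  2 * I + 4 * L      ≤⟨ +-monoˡ-≤ (4 * L) 2I≤n+2A ⟩
  n + 2 * A + 4 * L  ∎)
  where
  open ≤-Reasoning
  e₁ : ∀ n A → n + 2 * A + 3 * n ≡ 2 * (A + n * 2)
  e₁ = solve-∀
  e₂ : ∀ I L → 2 * (I + 2 * L) ≡ 2 * I + 4 * L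
  e₂ = solve-∀

3q+r≤L : ∀ q r L → r < 4 → 3 * (r + q * 4) ≤ 4 * L → 3 * q + r ≤ L
3q+r≤L q r L r<4 3[r+q*4]≤4L with 3 * q + r ≤? L
... | yes le     = le
... | no  3q+r≰L = ⊥-elim (<⇒≱ r<4 (+-cancelˡ-≤ (3 * r) 4 r (+-cancelˡ-≤ (12 * q) _ _ (begin
  12 * q + (3 * r + 4)  ≡⟨ e₁ q r ⟩
  3 * (r + q * 4) + 4   ≤⟨ +-monoˡ-≤ 4 3[r+q*4]≤4L ⟩
  4 * L + 4             ≡⟨ e₂ L ⟩
  4 * suc L             ≤⟨ *-monoʳ-≤ 4 (≰⇒> 3q+r≰L) ⟩
  4 * (3 * q + r)       ≡⟨ e₃ q r ⟩
  12 * q + (3 * r + r)  ∎))))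
  where
  open ≤-Reasoning
  e₁ : ∀ q r → 12 * q + (3 * r + 4) ≡ 3 * (r + q * 4) + 4
  e₁ = solve-∀
  e₂ : ∀ L → 4 * L + 4 ≡ 4 * suc L
  e₂ = solve-∀
  e₃ : ∀ q r → 4 * (3 * q + r) ≡ 12 * q + (3 * r + r)
  e₃ = solve-∀

-- The discharging certificate

data Label : Set where
  chosen covered uncovered : Label

Column : Set
Column = Label × Label

isChosen isUncovered : Label → Bool
isChosen chosen = true
isChosen _      = false
isUncovered uncovered = true
isUncovered _         = false

chosenIn uncoveredIn : Column → ℕ
chosenIn    (a , b) = 𝟙 (isChosen a) + 𝟙 (isChosen b)
uncoveredIn (a , b) = 𝟙 (isUncovered a) + 𝟙 (isUncovered b)

independent : Label → Label → Bool
independent uncovered uncovered = false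
independent _         _         = true

dominated : Label → Label → Label → Label → Bool
dominated uncovered x y z = isChosen x ∨ isChosen y ∨ isChosen z
dominated _         _ _ _ = true

-- Column c_i holds the labels of (v_{j+i}, u_{j+i}); the conditions are the edges inside
-- the window and the neighbourhoods of v_{j+1}, v_{j+2}, v_{j+3} and u_{j+2}.
admissible : Column → Column → Column → Column → Column → Bool
admissible (a₀ , b₀) (a₁ , b₁) (a₂ , b₂) (a₃ , b₃) (a₄ , b₄) =
  independent a₀ a₁ ∧ independent a₁ a₂ ∧ independent a₂ a₃ ∧ independent a₃ a₄ ∧
  independent a₀ b₀ ∧ independent a₁ b₁ ∧ independent a₂ b₂ ∧ independent a₃ b₃ ∧
  independent a₄ b₄ ∧ independent b₀ b₂ ∧ independent b₁ b₃ ∧ independent b₂ b₄ ∧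
  dominated a₁ a₀ a₂ b₁ ∧ dominated a₂ a₁ a₃ b₂ ∧ dominated a₃ a₂ a₄ b₃ ∧
  dominated b₂ b₀ b₄ a₂

-- Found by a Bellman–Ford search for a feasible potential on the graph of admissible windows.
potential : Column → Column → Column → Column → ℕ
potential (covered , covered) (_ , covered) (_ , _) (_ , _)          = 2
potential (covered , covered) (_ , uncovered) (_ , _) (_ , _)        = 2
potential (covered , covered) (_ , chosen) (_ , _) (_ , _)           = 1
potential (covered , uncovered) (_ , covered) (_ , chosen) (_ , _)   = 2
potential (covered , uncovered) (_ , covered) (_ , _) (_ , _)        = 3
potential (covered , uncovered) (chosen , uncovered) (_ , _) (_ , _) = 3
potential (covered , uncovered) (_ , uncovered) (_ , chosen) (_ , _) = 3
potential (covered , uncovered) (_ , uncovered) (_ , _) (_ , chosen) = 3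
potential (covered , uncovered) (_ , uncovered) (_ , _) (_ , _)      = 4
potential (covered , uncovered) (_ , chosen) (_ , _) (_ , _)         = 2
potential (covered , chosen) (_ , covered) (_ , _) (_ , _)           = 1
potential (covered , chosen) (_ , uncovered) (_ , _) (_ , _)         = 2
potential (covered , chosen) (_ , chosen) (_ , _) (_ , _)            = 1
potential (uncovered , covered) (chosen , covered) (_ , _) (_ , _)   = 2
potential (uncovered , covered) (_ , covered) (_ , _) (_ , _)        = 3
potential (uncovered , covered) (chosen , uncovered) (_ , _) (_ , _) = 3
potential (uncovered , covered) (_ , uncovered) (_ , _) (_ , _)      = 4
potential (uncovered , covered) (chosen , chosen) (_ , _) (_ , _)    = 1
potential (uncovered , covered) (_ , chosen) (_ , _) (_ , _)         = 3
potential (uncovered , uncovered) (_ , _) (_ , _) (_ , _)            = 0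
potential (uncovered , chosen) (_ , covered) (_ , _) (_ , _)         = 1
potential (uncovered , chosen) (chosen , uncovered) (_ , _) (_ , _)  = 2
potential (uncovered , chosen) (_ , uncovered) (_ , _) (_ , chosen)  = 2
potential (uncovered , chosen) (_ , uncovered) (_ , _) (_ , _)       = 4
potential (uncovered , chosen) (_ , chosen) (_ , _) (_ , _)          = 1
potential (chosen , covered) (_ , covered) (_ , _) (_ , _)           = 1
potential (chosen , covered) (chosen , uncovered) (_ , _) (_ , _)    = 1
potential (chosen , covered) (_ , uncovered) (_ , _) (_ , chosen)    = 1
potential (chosen , covered) (_ , uncovered) (_ , _) (_ , _)         = 2
potential (chosen , covered) (_ , chosen) (_ , _) (_ , _)            = 1
potential (chosen , uncovered) (_ , covered) (_ , _) (_ , _)         = 2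
potential (chosen , uncovered) (chosen , uncovered) (_ , _) (_ , _)  = 2
potential (chosen , uncovered) (_ , uncovered) (_ , _) (_ , chosen)  = 2
potential (chosen , uncovered) (_ , uncovered) (_ , _) (_ , _)       = 3
potential (chosen , uncovered) (_ , chosen) (_ , _) (_ , _)          = 2
potential (chosen , chosen) (_ , covered) (_ , _) (_ , _)            = 0
potential (chosen , chosen) (chosen , uncovered) (_ , _) (_ , _)     = 0
potential (chosen , chosen) (_ , uncovered) (_ , _) (_ , chosen)     = 0
potential (chosen , chosen) (_ , uncovered) (_ , _) (_ , _)          = 2
potential (chosen , chosen) (_ , chosen) (_ , _) (_ , _)             = 0

discharges : Column → Column → Column → Column → Column → Bool
discharges c₀ c₁ c₂ c₃ c₄ =
  2 * uncoveredIn c₀ + potential c₁ c₂ c₃ c₄ ≤ᵇ 1 + 2 * chosenIn c₀ + potential c₀ c₁ c₂ c₃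

infixr 6 _∧ᵀ_
_∧ᵀ_ : ∀ {a b} → T a → T b → T (a ∧ b)
p ∧ᵀ q = Equivalence.from T-∧ (p , q)

everyLabel : (Label → Bool) → Bool
everyLabel p = p chosen ∧ p covered ∧ p uncovered

everyLabel-sound : ∀ p → everyLabel p ≡ true → ∀ l → p l ≡ true
everyLabel-sound p h chosen    = ∧-conicalˡ (p chosen) _ h
everyLabel-sound p h covered   = ∧-conicalˡ (p covered) _ (∧-conicalʳ (p chosen) _ h)
everyLabel-sound p h uncovered = ∧-conicalʳ (p covered) _ (∧-conicalʳ (p chosen) _ h)

everyColumn : (Column → Bool) → Bool
everyColumn p = everyLabel λ a → everyLabel λ b → p (a , b)

everyColumn-sound : ∀ p → everyColumn p ≡ true → ∀ c → p c ≡ true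
everyColumn-sound p h (a , b) =
  everyLabel-sound (λ b → p (a , b)) (everyLabel-sound (λ a → everyLabel λ b → p (a , b)) h a) b

certificate : Column → Column → Column → Column → Column → Bool
certificate c₀ c₁ c₂ c₃ c₄ =
  if admissible c₀ c₁ c₂ c₃ c₄ then discharges c₀ c₁ c₂ c₃ c₄ else true

certificate-holds : ∀ c₀ c₁ c₂ c₃ c₄ → certificate c₀ c₁ c₂ c₃ c₄ ≡ true
certificate-holds c₀ c₁ c₂ c₃ c₄ =
  sound (certificate c₀ c₁ c₂ c₃) (sound (every₁ c₀ c₁ c₂) (sound (every₂ c₀ c₁)
    (sound (every₃ c₀) (sound every₄ refl c₀) c₁) c₂) c₃) c₄
  where
  -- Naming the partially applied predicates lets Agda see through the nested quantifiers.
  sound : ∀ p → everyColumn p ≡ true → ∀ c → p c ≡ true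
  sound = everyColumn-sound
  every₁ : Column → Column → Column → Column → Bool
  every₁ c₀ c₁ c₂ c₃ = everyColumn (certificate c₀ c₁ c₂ c₃)
  every₂ : Column → Column → Column → Bool
  every₂ c₀ c₁ c₂ = everyColumn (every₁ c₀ c₁ c₂)
  every₃ : Column → Column → Bool
  every₃ c₀ c₁ = everyColumn (every₂ c₀ c₁)
  every₄ : Column → Bool
  every₄ c₀ = everyColumn (every₃ c₀)

discharging : ∀ c₀ c₁ c₂ c₃ c₄ → T (admissible c₀ c₁ c₂ c₃ c₄) →
  2 * uncoveredIn c₀ + potential c₁ c₂ c₃ c₄ ≤ 1 + 2 * chosenIn c₀ + potential c₀ c₁ c₂ c₃
discharging c₀ c₁ c₂ c₃ c₄ adm =
  ≤ᵇ⇒≤ _ _ (ifTrue (admissible c₀ c₁ c₂ c₃ c₄) adm (certificate-holds c₀ c₁ c₂ c₃ c₄))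
  where
  ifTrue : ∀ b {d} → T b → (if b then d else true) ≡ true → T d
  ifTrue true _ refl = tt

label : ∀ {A B : Set} → Dec A → Dec B → Label
label (yes _) _       = chosen
label (no _)  (yes _) = covered
label (no _)  (no _)  = uncovered

label-chosen : ∀ {A B : Set} (a? : Dec A) (b? : Dec B) → A → label a? b? ≡ chosen
label-chosen (yes _) _ _ = refl
label-chosen (no ¬a) _ a = ⊥-elim (¬a a)

label-covered : ∀ {A B : Set} (a? : Dec A) (b? : Dec B) → B → label a? b? ≢ uncovered
label-covered (yes _) _       _ ()
label-covered (no _)  (yes _) _ ()
label-covered (no _)  (no ¬b) b _ = ¬b b

label-count : ∀ {A B : Set} (a? : Dec A) (b? : Dec B) → (A → B) →
  𝟙 (isChosen (label a? b?)) + 1 ≤ 𝟙 (isUncovered (label a? b?)) + (𝟙 (does a?) + 𝟙 (does b?))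
label-count (yes _) (yes _) _   = ≤-refl
label-count (yes a) (no ¬b) a⇒b = ⊥-elim (¬b (a⇒b a))
label-count (no _)  (yes _) _   = ≤-refl
label-count (no _)  (no _)  _   = ≤-refl

independent-if : ∀ {l₁ l₂} → l₁ ≢ uncovered ⊎ l₂ ≢ uncovered → T (independent l₁ l₂)
independent-if {chosen}                _          = tt
independent-if {covered}               _          = tt
independent-if {uncovered} {chosen}    _          = tt
independent-if {uncovered} {covered}   _          = tt
independent-if {uncovered} {uncovered} (inj₁ ≢uc) = ≢uc refl
independent-if {uncovered} {uncovered} (inj₂ ≢uc) = ≢uc refl

dominated-if : ∀ l {l₁ l₂ l₃} → l ≢ uncovered ⊎ (l₁ ≡ chosen ⊎ l₂ ≡ chosen ⊎ l₃ ≡ chosen) →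
               T (dominated l l₁ l₂ l₃)
dominated-if chosen    _                         = tt
dominated-if covered   _                         = tt
dominated-if uncovered (inj₁ ≢uc)                = ⊥-elim (≢uc refl)
dominated-if uncovered (inj₂ (inj₁ refl))        = tt
dominated-if uncovered (inj₂ (inj₂ (inj₁ refl))) = Equivalence.from T-∨ (inj₂ tt)
dominated-if uncovered {l₁} (inj₂ (inj₂ (inj₂ refl))) =
  Equivalence.from (T-∨ {isChosen l₁}) (inj₂ (Equivalence.from T-∨ (inj₂ tt)))

module _ {A : Set} where

  ∈-take₀ : ∀ {k} {x : A} {xs} → 0 < k → x ∈ take k (x ∷ xs)
  ∈-take₀ {suc _} _ = here refl

  ∈-take₁ : ∀ {k} {x y : A} {xs} → 1 < k → y ∈ take k (x ∷ y ∷ xs)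
  ∈-take₁ {suc _} (s≤s 0<k) = there (∈-take₀ 0<k)

  ∈-take₂ : ∀ {k} {x y z : A} {xs} → 2 < k → z ∈ take k (x ∷ y ∷ z ∷ xs)
  ∈-take₂ {suc _} (s≤s 1<k) = there (∈-take₁ 1<k)

-- Mixed domination through covered vertices

module Covering {V : Set} {Adj : V → V → Set} where

  open MixedDomination V Adj

  _∈ᵉ_ : V → Elem → Set
  x ∈ᵉ inj₁ y = x ≡ y
  x ∈ᵉ inj₂ e = Incident x e

  Covered Chosen : List Elem → V → Set
  Covered S x = Any (x ∈ᵉ_) S
  Chosen  S x = Any (SameElem (inj₁ x)) S

  EdgesCovered VerticesDominated : List Elem → Set
  EdgesCovered      S = ∀ {x y} → Adj x y → Covered S x ⊎ Covered S y
  VerticesDominated S = ∀ x → Covered S x ⊎ ∃[ y ] (Adj x y × Chosen S y)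

  sameVertex⇒∈ᵉ : ∀ {x} s → SameElem (inj₁ x) s → x ∈ᵉ s
  sameVertex⇒∈ᵉ (inj₁ _) x≡y = x≡y

  chosen⇒covered : ∀ {S x} → Chosen S x → Covered S x
  chosen⇒covered = Any.map λ {s} → sameVertex⇒∈ᵉ s

  module _ {x y : V} {p : Adj x y} where

    private
      e : Edge
      e = x , y , p

    endpoint-on-same : ∀ s → SameElem (inj₂ e) s → x ∈ᵉ s ⊎ y ∈ᵉ s
    endpoint-on-same (inj₂ _) (inj₁ (x≡ , _)) = inj₁ (inj₁ x≡)
    endpoint-on-same (inj₂ _) (inj₂ (x≡ , _)) = inj₁ (inj₂ x≡)

    endpoint-on-adjacent : ∀ s → AdjOrInc (inj₂ e) s → x ∈ᵉ s ⊎ y ∈ᵉ s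
    endpoint-on-adjacent (inj₁ _) (inj₁ b≡x)            = inj₁ (sym b≡x)
    endpoint-on-adjacent (inj₁ _) (inj₂ b≡y)            = inj₂ (sym b≡y)
    endpoint-on-adjacent (inj₂ _) (_ , inj₁ refl , x∈f) = inj₁ x∈f
    endpoint-on-adjacent (inj₂ _) (_ , inj₂ refl , y∈f) = inj₂ y∈f

    adjacent-via-endpoint : ∀ {z} s → Incident z e → z ∈ᵉ s → AdjOrInc (inj₂ e) s
    adjacent-via-endpoint (inj₁ _) z∈e refl = z∈e
    adjacent-via-endpoint (inj₂ _) z∈e z∈f  = _ , z∈e , z∈f

  covered-or-chosen-neighbour : ∀ {S x} → Any (AdjOrInc (inj₁ x)) S →
                                Covered S x ⊎ ∃[ y ] (Adj x y × Chosen S y)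
  covered-or-chosen-neighbour (here {inj₁ y} xy)  = inj₂ (y , xy , here refl)
  covered-or-chosen-neighbour (here {inj₂ _} x∈f) = inj₁ (here x∈f)
  covered-or-chosen-neighbour (there a) with covered-or-chosen-neighbour a
  ... | inj₁ cov            = inj₁ (there cov)
  ... | inj₂ (y , xy , cho) = inj₂ (y , xy , there cho)

  dominating⇒edgesCovered : ∀ {S} → IsMixedDominating S → EdgesCovered S
  dominating⇒edgesCovered D {x} {y} p with D (inj₂ (x , y , p))
  ... | inj₁ same = Any-⊎⁻ (Any.map (λ {s} → endpoint-on-same s) same)
  ... | inj₂ adj  = Any-⊎⁻ (Any.map (λ {s} → endpoint-on-adjacent s) adj)

  dominating⇒verticesDominated : ∀ {S} → IsMixedDominating S → VerticesDominated S
  dominating⇒verticesDominated D x with D (inj₁ x)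
  ... | inj₁ same = inj₁ (chosen⇒covered same)
  ... | inj₂ adj  = covered-or-chosen-neighbour adj

  covering⇒dominating : ∀ {S} → EdgesCovered S → VerticesDominated S → IsMixedDominating S
  covering⇒dominating _  vd (inj₁ x) with vd x
  ... | inj₁ cov = Any-⊎⁻ (Any.map (λ {s} → on s) cov)
    where
    on : ∀ s → x ∈ᵉ s → SameElem (inj₁ x) s ⊎ AdjOrInc (inj₁ x) s
    on (inj₁ _) x≡y = inj₁ x≡y
    on (inj₂ _) x∈f = inj₂ x∈f
  ... | inj₂ (y , xy , cho) = inj₂ (Any.map (λ {s} → via s) cho)
    where
    via : ∀ s → SameElem (inj₁ y) s → AdjOrInc (inj₁ x) s
    via (inj₁ _) refl = xy
  covering⇒dominating ec _ (inj₂ (x , y , p)) with ec p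
  ... | inj₁ cov = inj₂ (Any.map (λ {s} → adjacent-via-endpoint s (inj₁ refl)) cov)
  ... | inj₂ cov = inj₂ (Any.map (λ {s} → adjacent-via-endpoint s (inj₂ refl)) cov)

  module Decisions (_≟_ : DecidableEquality V) where

    _∈ᵉ?_ : ∀ x s → Dec (x ∈ᵉ s)
    x ∈ᵉ? inj₁ y           = x ≟ y
    x ∈ᵉ? inj₂ (a , b , _) = (x ≟ a) ⊎-dec (x ≟ b)

    sameVertex? : ∀ x s → Dec (SameElem (inj₁ x) s)
    sameVertex? x (inj₁ y) = x ≟ y
    sameVertex? x (inj₂ _) = no λ ()

    covered? : ∀ S x → Dec (Covered S x)
    covered? S x = any? (x ∈ᵉ?_) S

    chosen? : ∀ S x → Dec (Chosen S x)
    chosen? S x = any? (sameVertex? x) S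

    incidences : List Elem → V → ℕ
    incidences S x = 𝟙 (does (chosen? S x)) + 𝟙 (does (covered? S x))

    weight : Elem → V → ℕ
    weight s x = 𝟙 (does (sameVertex? x s)) + 𝟙 (does (x ∈ᵉ? s))

    incidences-∷ : ∀ s S x → incidences (s ∷ S) x ≤ weight s x + incidences S x
    incidences-∷ s S x = ≤-trans
      (+-mono-≤ (𝟙-∨ (does (sameVertex? x s)) _) (𝟙-∨ (does (x ∈ᵉ? s)) _))
      (≤-reflexive (interchange (𝟙 (does (sameVertex? x s))) (𝟙 (does (chosen? S x)))
                                 (𝟙 (does (x ∈ᵉ? s))) (𝟙 (does (covered? S x)))))

    weight-≤-ends : ∀ s → ∃[ a ] ∃[ b ] (∀ x → weight s x ≤ 𝟙 (does (x ≟ a)) + 𝟙 (does (x ≟ b)))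
    weight-≤-ends (inj₁ y)           = y , y , λ x → ≤-refl
    weight-≤-ends (inj₂ (a , b , _)) = a , b , λ x → 𝟙-∨ (does (x ≟ a)) (does (x ≟ b))

v-injective : ∀ {n} {i j : Fin n} → v i ≡ v j → i ≡ j
v-injective refl = refl

u-injective : ∀ {n} {i j : Fin n} → u i ≡ u j → i ≡ j
u-injective refl = refl

_≟ᵛ_ : ∀ {n} → DecidableEquality (Vtx n)
v i ≟ᵛ v j = Dec.map′ (cong v) v-injective (i Fin.≟ j)
u i ≟ᵛ u j = Dec.map′ (cong u) u-injective (i Fin.≟ j)
v _ ≟ᵛ u _ = no λ ()
u _ ≟ᵛ v _ = no λ ()

module Petersen (n : ℕ) .{{_ : NonZero n}} (2≤n : 2 ≤ n) where

  open MixedDomination (Vtx n) (PAdj n 2)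
  open Covering {Vtx n} {PAdj n 2}
  open Decisions _≟ᵛ_

  ι : ℕ → Fin n
  ι j = fromℕ< (m%n<n j n)

  V U : ℕ → Vtx n
  V j = v (ι j)
  U j = u (ι j)

  toℕ-ι : ∀ j → toℕ (ι j) ≡ j % n
  toℕ-ι j = toℕ-fromℕ< (m%n<n j n)

  ι-cong : ∀ {j k} → j % n ≡ k % n → ι j ≡ ι k
  ι-cong {j} {k} eq = toℕ-injective (trans (toℕ-ι j) (trans eq (sym (toℕ-ι k))))

  ι-injective : ∀ {j k} → j < n → k < n → ι j ≡ ι k → j ≡ k
  ι-injective {j} {k} j<n k<n eq = begin
    j          ≡⟨ m<n⇒m%n≡m j<n ⟨
    j % n      ≡⟨ toℕ-ι j ⟨
    toℕ (ι j)  ≡⟨ cong toℕ eq ⟩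
    toℕ (ι k)  ≡⟨ toℕ-ι k ⟩
    k % n      ≡⟨ m<n⇒m%n≡m k<n ⟩
    k          ∎
    where open ≡-Reasoning

  ι-toℕ : ∀ i → ι (toℕ i) ≡ i
  ι-toℕ i = toℕ-injective (trans (toℕ-ι (toℕ i)) (m<n⇒m%n≡m (toℕ<n i)))

  ι-+n : ∀ j → ι (j + n) ≡ ι j
  ι-+n j = ι-cong ([m+n]%n≡m%n j n)

  plus-ι : ∀ j d → plus (ι j) d ≡ ι (d + j)
  plus-ι j d = ι-cong (begin
    (toℕ (ι j) + d) % n      ≡⟨ cong (λ t → (t + d) % n) (toℕ-ι j) ⟩
    (j % n + d) % n          ≡⟨ %-distribˡ-+ (j % n) d n ⟩
    (j % n % n + d % n) % n  ≡⟨ cong (λ t → (t + d % n) % n) (m%n%n≡m%n j n) ⟩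
    (j % n + d % n) % n      ≡⟨ %-distribˡ-+ j d n ⟨
    (j + d) % n              ≡⟨ cong (_% n) (+-comm j d) ⟩
    (d + j) % n              ∎)
    where open ≡-Reasoning

  plus-injective : ∀ {i i'} d → d ≤ n → plus i d ≡ plus i' d → i ≡ i'
  plus-injective {i} {i'} d d≤n eq =
    trans (sym (back i)) (trans (cong (λ k → plus k (n ∸ d)) eq) (back i'))
    where
    open ≡-Reasoning
    back : ∀ i → plus (plus i d) (n ∸ d) ≡ i
    back i = begin
      plus (plus i d) (n ∸ d)      ≡⟨ plus-ι (toℕ i + d) (n ∸ d) ⟩
      ι (n ∸ d + (toℕ i + d))      ≡⟨ cong (λ t → ι (n ∸ d + t)) (+-comm (toℕ i) d) ⟩
      ι (n ∸ d + (d + toℕ i))      ≡⟨ cong ι (+-assoc (n ∸ d) d (toℕ i)) ⟨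
      ι (n ∸ d + d + toℕ i)        ≡⟨ cong (λ t → ι (t + toℕ i)) (m∸n+n≡m d≤n) ⟩
      ι (n + toℕ i)                ≡⟨ cong ι (+-comm n (toℕ i)) ⟩
      ι (toℕ i + n)                ≡⟨ ι-+n (toℕ i) ⟩
      ι (toℕ i)                    ≡⟨ ι-toℕ i ⟩
      i                            ∎

  rim-adj : ∀ j → PAdj n 2 (V j) (V (suc j))
  rim-adj j = inj₁ (subst (λ i → PEdge n 2 (V j) (v i)) (plus-ι j 1) (rim (ι j)))

  spoke-adj : ∀ j → PAdj n 2 (V j) (U j)
  spoke-adj j = inj₁ (spoke (ι j))

  inner-adj : ∀ j → PAdj n 2 (U j) (U (2 + j))
  inner-adj j = inj₁ (subst (λ i → PEdge n 2 (U j) (u i)) (plus-ι j 2) (inner (ι j)))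

  V-neighbours : ∀ j {y} → PAdj n 2 (V (1 + j)) y → y ≡ V j ⊎ y ≡ V (2 + j) ⊎ y ≡ U (1 + j)
  V-neighbours j p = go p refl
    where
    go : ∀ {x y} → PAdj n 2 x y → x ≡ V (1 + j) → y ≡ V j ⊎ y ≡ V (2 + j) ⊎ y ≡ U (1 + j)
    go (inj₁ (rim _))   refl = inj₂ (inj₁ (cong v (plus-ι (1 + j) 1)))
    go (inj₁ (spoke _)) refl = inj₂ (inj₂ refl)
    go (inj₁ (inner _)) ()
    go (inj₂ (rim _))   eq   = inj₁ (cong v (plus-injective 1 (≤-trans (s≤s z≤n) 2≤n)
                                              (trans (v-injective eq) (sym (plus-ι j 1)))))
    go (inj₂ (spoke _)) ()
    go (inj₂ (inner _)) ()

  U-neighbours : ∀ j {y} → PAdj n 2 (U (2 + j)) y → y ≡ U j ⊎ y ≡ U (4 + j) ⊎ y ≡ V (2 + j)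
  U-neighbours j p = go p refl
    where
    go : ∀ {x y} → PAdj n 2 x y → x ≡ U (2 + j) → y ≡ U j ⊎ y ≡ U (4 + j) ⊎ y ≡ V (2 + j)
    go (inj₁ (rim _))   ()
    go (inj₁ (spoke _)) ()
    go (inj₁ (inner _)) refl = inj₂ (inj₁ (cong u (plus-ι (2 + j) 2)))
    go (inj₂ (rim _))   ()
    go (inj₂ (spoke _)) refl = inj₂ (inj₂ refl)
    go (inj₂ (inner _)) eq   = inj₁ (cong u (plus-injective 2 2≤n
                                              (trans (u-injective eq) (sym (plus-ι j 2)))))

  Vtx-elim : ∀ {P : Vtx n → Set} → (∀ j → j < n → P (V j)) → (∀ j → j < n → P (U j)) → ∀ x → P x
  Vtx-elim {P} PV _  (v i) = subst P (cong v (ι-toℕ i)) (PV (toℕ i) (toℕ<n i))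
  Vtx-elim {P} _  PU (u i) = subst P (cong u (ι-toℕ i)) (PU (toℕ i) (toℕ<n i))

  PEdge-elim : ∀ {P : Vtx n → Vtx n → Set} →
    (∀ j → j < n → P (V j) (V (1 + j))) → (∀ j → j < n → P (V j) (U j)) →
    (∀ j → j < n → P (U j) (U (2 + j))) → ∀ {a b} → PEdge n 2 a b → P a b
  PEdge-elim {P} Prim _ _ (rim i) =
    subst₂ P (cong v (ι-toℕ i)) (cong (v ∘ ι) (+-comm 1 (toℕ i))) (Prim (toℕ i) (toℕ<n i))
  PEdge-elim {P} _ Pspoke _ (spoke i) =
    subst₂ P (cong v (ι-toℕ i)) (cong u (ι-toℕ i)) (Pspoke (toℕ i) (toℕ<n i))
  PEdge-elim {P} _ _ Pinner (inner i) =
    subst₂ P (cong u (ι-toℕ i)) (cong (u ∘ ι) (+-comm 2 (toℕ i))) (Pinner (toℕ i) (toℕ<n i))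

  ∑ᵛ : (Vtx n → ℕ) → ℕ
  ∑ᵛ g = ∑< n (λ j → g (V j) + g (U j))

  ∑ᵛ-mono : ∀ {f g} → (∀ x → f x ≤ g x) → ∑ᵛ f ≤ ∑ᵛ g
  ∑ᵛ-mono f≤g = ∑<-mono n λ j _ → +-mono-≤ (f≤g (V j)) (f≤g (U j))

  ∑ᵛ-+ : ∀ f g → ∑ᵛ (λ x → f x + g x) ≡ ∑ᵛ f + ∑ᵛ g
  ∑ᵛ-+ f g = trans (∑<-cong n λ j → interchange (f (V j)) (g (V j)) (f (U j)) (g (U j)))
                   (∑<-+ n _ _)

  ∑ᵛ-≟ : ∀ y → ∑ᵛ (λ x → 𝟙 (does (x ≟ᵛ y))) ≤ 1
  ∑ᵛ-≟ (v i) = ≤-trans (∑<-mono n λ j _ → ≤-reflexive (+-identityʳ _))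
                       (∑<-𝟙-unique (λ j → V j ≟ᵛ v i) n λ j<n k<n Vj≡ Vk≡ →
                          ι-injective j<n k<n (v-injective (trans Vj≡ (sym Vk≡))))
  ∑ᵛ-≟ (u i) = ∑<-𝟙-unique (λ j → U j ≟ᵛ u i) n λ j<n k<n Uj≡ Uk≡ →
                 ι-injective j<n k<n (u-injective (trans Uj≡ (sym Uk≡)))

  ∑ᵛ-weight : ∀ s → ∑ᵛ (weight s) ≤ 2
  ∑ᵛ-weight s with weight-≤-ends s
  ... | a , b , w≤ = begin
    ∑ᵛ (weight s)                ≤⟨ ∑ᵛ-mono w≤ ⟩
    ∑ᵛ (λ x → is a x + is b x)   ≡⟨ ∑ᵛ-+ (is a) (is b) ⟩
    ∑ᵛ (is a) + ∑ᵛ (is b)        ≤⟨ +-mono-≤ (∑ᵛ-≟ a) (∑ᵛ-≟ b) ⟩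
    2                            ∎
    where
    open ≤-Reasoning
    is : Vtx n → Vtx n → ℕ
    is y x = 𝟙 (does (x ≟ᵛ y))

  ∑ᵛ-incidences : ∀ S → ∑ᵛ (incidences S) ≤ 2 * length S
  ∑ᵛ-incidences []      = ≤-reflexive (trans (∑<-const n 0) (*-zeroʳ n))
  ∑ᵛ-incidences (s ∷ S) = begin
    ∑ᵛ (incidences (s ∷ S))                  ≤⟨ ∑ᵛ-mono (incidences-∷ s S) ⟩
    ∑ᵛ (λ x → weight s x + incidences S x)   ≡⟨ ∑ᵛ-+ (weight s) (incidences S) ⟩
    ∑ᵛ (weight s) + ∑ᵛ (incidences S)        ≤⟨ +-mono-≤ (∑ᵛ-weight s) (∑ᵛ-incidences S) ⟩
    2 + 2 * length S                         ≡⟨ *-distribˡ-+ 2 1 (length S) ⟨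
    2 * length (s ∷ S)                       ∎
    where open ≤-Reasoning

  module LowerBound (S : List Elem) (D : IsMixedDominating S) where

    labelOf : Vtx n → Label
    labelOf x = label (chosen? S x) (covered? S x)

    col : ℕ → Column
    col j = labelOf (V j) , labelOf (U j)

    edge-independent : ∀ {x y} → PAdj n 2 x y → T (independent (labelOf x) (labelOf y))
    edge-independent {x} {y} p = independent-if (Sum.map
      (label-covered (chosen? S x) (covered? S x)) (label-covered (chosen? S y) (covered? S y))
      (dominating⇒edgesCovered D p))

    chosen-label : ∀ {y y'} → Chosen S y → y ≡ y' → labelOf y' ≡ chosen
    chosen-label {y} cho refl = label-chosen (chosen? S y) (covered? S y) cho

    vertex-dominated : ∀ x {y₁ y₂ y₃} → (∀ {y} → PAdj n 2 x y → y ≡ y₁ ⊎ y ≡ y₂ ⊎ y ≡ y₃) →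
                       T (dominated (labelOf x) (labelOf y₁) (labelOf y₂) (labelOf y₃))
    vertex-dominated x {y₁} {y₂} {y₃} neighbours with dominating⇒verticesDominated D x
    ... | inj₁ cov            = dominated-if (labelOf x) {labelOf y₁} {labelOf y₂} {labelOf y₃}
            (inj₁ (label-covered (chosen? S x) (covered? S x) cov))
    ... | inj₂ (y , xy , cho) =
      dominated-if (labelOf x) (inj₂ (Sum.map ch (Sum.map ch ch) (neighbours xy)))
      where
      ch : ∀ {y'} → y ≡ y' → labelOf y' ≡ chosen
      ch = chosen-label cho

    window-admissible : ∀ j →
      T (admissible (col j) (col (1 + j)) (col (2 + j)) (col (3 + j)) (col (4 + j)))
    window-admissible j =
      rimᵀ j ∧ᵀ rimᵀ (1 + j) ∧ᵀ rimᵀ (2 + j) ∧ᵀ rimᵀ (3 + j) ∧ᵀ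
      spokeᵀ j ∧ᵀ spokeᵀ (1 + j) ∧ᵀ spokeᵀ (2 + j) ∧ᵀ spokeᵀ (3 + j) ∧ᵀ spokeᵀ (4 + j) ∧ᵀ
      innerᵀ j ∧ᵀ innerᵀ (1 + j) ∧ᵀ innerᵀ (2 + j) ∧ᵀ
      vertex-dominated (V (1 + j)) (V-neighbours j) ∧ᵀ
      vertex-dominated (V (2 + j)) (V-neighbours (1 + j)) ∧ᵀ
      vertex-dominated (V (3 + j)) (V-neighbours (2 + j)) ∧ᵀ
      vertex-dominated (U (2 + j)) (U-neighbours j)
      where
      rimᵀ : ∀ k → T (independent (labelOf (V k)) (labelOf (V (suc k))))
      rimᵀ k = edge-independent (rim-adj k)
      spokeᵀ : ∀ k → T (independent (labelOf (V k)) (labelOf (U k)))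
      spokeᵀ k = edge-independent (spoke-adj k)
      innerᵀ : ∀ k → T (independent (labelOf (U k)) (labelOf (U (2 + k))))
      innerᵀ k = edge-independent (inner-adj k)

    Φ : ℕ → ℕ
    Φ j = potential (col j) (col (1 + j)) (col (2 + j)) (col (3 + j))

    col-periodic : ∀ k → col (k + n) ≡ col k
    col-periodic k = cong₂ _,_ (cong (labelOf ∘ v) (ι-+n k)) (cong (labelOf ∘ u) (ι-+n k))

    Φ-periodic : Φ n ≡ Φ 0
    Φ-periodic = cong₂ (λ (c₀ , c₁) (c₂ , c₃) → potential c₀ c₁ c₂ c₃)
      (cong₂ _,_ (col-periodic 0) (col-periodic 1)) (cong₂ _,_ (col-periodic 2) (col-periodic 3))

    discharge-at : ∀ j → 2 * uncoveredIn (col j) + Φ (suc j) ≤ 1 + 2 * chosenIn (col j) + Φ j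
    discharge-at j = discharging (col j) (col (1 + j)) (col (2 + j)) (col (3 + j)) (col (4 + j))
                       (window-admissible j)

    #chosen #uncovered : ℕ
    #chosen    = ∑< n (chosenIn ∘ col)
    #uncovered = ∑< n (uncoveredIn ∘ col)

    uncovered-bound : 2 * #uncovered ≤ n + 2 * #chosen
    uncovered-bound = +-cancelʳ-≤ (∑< n Φ) _ _ (begin
      2 * #uncovered + ∑< n Φ
        ≡⟨ cong₂ _+_ (∑<-*ˡ n 2 (uncoveredIn ∘ col)) (∑<-rotate n Φ Φ-periodic) ⟨
      ∑< n (λ j → 2 * uncoveredIn (col j)) + ∑< n (λ j → Φ (suc j))
        ≡⟨ ∑<-+ n _ _ ⟨
      ∑< n (λ j → 2 * uncoveredIn (col j) + Φ (suc j))
        ≤⟨ ∑<-mono n (λ j _ → discharge-at j) ⟩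
      ∑< n (λ j → 1 + 2 * chosenIn (col j) + Φ j)
        ≡⟨ ∑<-+ n _ _ ⟩
      ∑< n (λ j → 1 + 2 * chosenIn (col j)) + ∑< n Φ
        ≡⟨ cong (_+ ∑< n Φ) (∑<-+ n _ _) ⟩
      ∑< n (λ _ → 1) + ∑< n (λ j → 2 * chosenIn (col j)) + ∑< n Φ
        ≡⟨ cong (λ t → t + ∑< n (λ j → 2 * chosenIn (col j)) + ∑< n Φ) ∑<-ones ⟩
      n + ∑< n (λ j → 2 * chosenIn (col j)) + ∑< n Φ
        ≡⟨ cong (λ t → n + t + ∑< n Φ) (∑<-*ˡ n 2 (chosenIn ∘ col)) ⟩
      n + 2 * #chosen + ∑< n Φ
        ∎)
      where
      open ≤-Reasoning
      ∑<-ones : ∑< n (λ _ → 1) ≡ n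
      ∑<-ones = trans (∑<-const n 1) (*-identityʳ n)

    chosen-bound : #chosen + n * 2 ≤ #uncovered + 2 * length S
    chosen-bound = begin
      #chosen + n * 2
        ≡⟨ cong (#chosen +_) (∑<-const n 2) ⟨
      ∑ᵛ (𝟙 ∘ isChosen ∘ labelOf) + ∑ᵛ (λ _ → 1)
        ≡⟨ ∑ᵛ-+ (𝟙 ∘ isChosen ∘ labelOf) (λ _ → 1) ⟨
      ∑ᵛ (λ x → 𝟙 (isChosen (labelOf x)) + 1)
        ≤⟨ ∑ᵛ-mono (λ x → label-count (chosen? S x) (covered? S x) chosen⇒covered) ⟩
      ∑ᵛ (λ x → 𝟙 (isUncovered (labelOf x)) + incidences S x)
        ≡⟨ ∑ᵛ-+ (𝟙 ∘ isUncovered ∘ labelOf) (incidences S) ⟩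
      #uncovered + ∑ᵛ (incidences S)
        ≤⟨ +-monoʳ-≤ #uncovered (∑ᵛ-incidences S) ⟩
      #uncovered + 2 * length S
        ∎
      where open ≤-Reasoning

    length-bound : 3 * (n / 4) + n % 4 ≤ length S
    length-bound = 3q+r≤L (n / 4) (n % 4) (length S) (m%n<n n 4)
      (subst (λ t → 3 * t ≤ 4 * length S) (m≡m%n+[m/n]*n n 4)
        (3n≤4L n #uncovered #chosen (length S) uncovered-bound chosen-bound))

  module Construction (m r : ℕ) (n≡r+m*4 : n ≡ r + m * 4) (r<4 : r < 4) (0<m : 0 < m) where

    spokeAt innerAt vertexAt : ℕ → Elem
    spokeAt  j = inj₂ (V j , U j , spoke-adj j)
    innerAt  j = inj₂ (U j , U (2 + j) , inner-adj j)
    vertexAt j = inj₁ (V j)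

    block : ℕ → List Elem
    block q = spokeAt (q * 4) ∷ innerAt (1 + q * 4) ∷ vertexAt (2 + q * 4) ∷ []

    blocks : ℕ → List Elem
    blocks zero    = []
    blocks (suc q) = block q ++ blocks q

    S : List Elem
    S = blocks m ++ take r (spokeAt (m * 4) ∷ vertexAt (1 + m * 4) ∷ vertexAt (2 + m * 4) ∷ [])

    length-S : length S ≡ 3 * m + r
    length-S = trans (length-++ (blocks m))
      (cong₂ _+_ (length-blocks m) (trans (length-take r _) (m≤n⇒m⊓n≡m (≤-pred r<4))))
      where
      length-blocks : ∀ q → length (blocks q) ≡ 3 * q
      length-blocks zero    = refl
      length-blocks (suc q) = trans (cong (3 +_) (length-blocks q)) (sym (*-suc 3 q))

    ∈-blocks : ∀ {e q} k → q < k → e ∈ block q → e ∈ blocks k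
    ∈-blocks (suc k) q<1+k e∈ with m≤n⇒m<n∨m≡n (≤-pred q<1+k)
    ... | inj₁ q<k  = ∈-++⁺ʳ (block k) (∈-blocks k q<k e∈)
    ... | inj₂ refl = ∈-++⁺ˡ e∈

    module _ {q} (q<m : q < m) where

      spoke∈S : spokeAt (q * 4) ∈ S
      spoke∈S = ∈-++⁺ˡ (∈-blocks m q<m (here refl))

      inner∈S : innerAt (1 + q * 4) ∈ S
      inner∈S = ∈-++⁺ˡ (∈-blocks m q<m (there (here refl)))

      vertex∈S : vertexAt (2 + q * 4) ∈ S
      vertex∈S = ∈-++⁺ˡ (∈-blocks m q<m (there (there (here refl))))

    tail-spoke∈S : 0 < r → spokeAt (m * 4) ∈ S
    tail-spoke∈S 0<r = ∈-++⁺ʳ (blocks m) (∈-take₀ 0<r)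

    tail-vertex₁∈S : 1 < r → vertexAt (1 + m * 4) ∈ S
    tail-vertex₁∈S 1<r = ∈-++⁺ʳ (blocks m) (∈-take₁ 1<r)

    tail-vertex₂∈S : 2 < r → vertexAt (2 + m * 4) ∈ S
    tail-vertex₂∈S 2<r = ∈-++⁺ʳ (blocks m) (∈-take₂ 2<r)

    covered-by : ∀ {e x} → e ∈ S → x ∈ᵉ e → Covered S x
    covered-by = lose

    chosen-by : ∀ {j} → vertexAt j ∈ S → Chosen S (V j)
    chosen-by w = lose w refl

    ι-wrap : ∀ {j} k → k + n ≡ j → ι k ≡ ι j
    ι-wrap k k+n≡j = trans (sym (ι-+n k)) (cong ι k+n≡j)

    next-spoke : ∀ {q} → q < m → Covered S (V (4 + q * 4)) × Covered S (U (4 + q * 4))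
    next-spoke {q} q<m with m≤n⇒m<n∨m≡n q<m | r ≟ 0
    ... | inj₁ 1+q<m | _      = covered-by (spoke∈S 1+q<m) (inj₁ refl) ,
                                covered-by (spoke∈S 1+q<m) (inj₂ refl)
    ... | inj₂ 1+q≡m | no r≢0 = covered-by tail-spoke (inj₁ refl) ,
                                covered-by tail-spoke (inj₂ refl)
      where
      tail-spoke : spokeAt (4 + q * 4) ∈ S
      tail-spoke = subst (λ t → spokeAt (t * 4) ∈ S) (sym 1+q≡m) (tail-spoke∈S (n≢0⇒n>0 r≢0))
    ... | inj₂ 1+q≡m | yes r≡0 =
      subst (Covered S) (cong v wrap) (covered-by (spoke∈S 0<m) (inj₁ refl)) ,
      subst (Covered S) (cong u wrap) (covered-by (spoke∈S 0<m) (inj₂ refl))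
      where
      wrap : ι 0 ≡ ι (4 + q * 4)
      wrap = ι-wrap 0 (trans n≡r+m*4 (cong₂ (λ r m → r + m * 4) r≡0 (sym 1+q≡m)))

    U-wrap : ∀ {j} k → k + n ≡ j → Covered S (U k) → Covered S (U j)
    U-wrap k k+n≡j = subst (Covered S) (cong u (ι-wrap k k+n≡j))

    n≡r′+m*4 : ∀ {r'} → r ≡ r' → n ≡ r' + m * 4
    n≡r′+m*4 r≡r' = trans n≡r+m*4 (cong (_+ m * 4) r≡r')

    tail-inner₁-covered : 1 < r → Covered S (U (3 + m * 4))
    tail-inner₁-covered 1<r with m≤n⇒m<n∨m≡n 1<r
    ... | inj₁ 2<r = U-wrap 0 (n≡r′+m*4 (≤-antisym (≤-pred r<4) 2<r))
                       (covered-by (spoke∈S 0<m) (inj₂ refl))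
    ... | inj₂ 2≡r = U-wrap 1 (cong suc (n≡r′+m*4 (sym 2≡r)))
                       (covered-by (inner∈S 0<m) (inj₁ refl))

    tail-inner₂-covered : 2 < r → Covered S (U (4 + m * 4))
    tail-inner₂-covered 2<r = U-wrap 1 (cong suc (n≡r′+m*4 (≤-antisym (≤-pred r<4) 2<r)))
                                (covered-by (inner∈S 0<m) (inj₁ refl))

    data Shape : ℕ → Set where
      spoke-shape     : ∀ {j} → spokeAt j ∈ S → Shape j
      inner-shape     : ∀ {j} → innerAt j ∈ S → vertexAt (1 + j) ∈ S → Shape j
      vertex-shape    : ∀ {j} → vertexAt j ∈ S → Covered S (U (2 + j)) → Shape j
      inner-end-shape : ∀ {k} → innerAt k ∈ S → vertexAt (1 + k) ∈ S → Covered S (V (3 + k)) →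
                        Shape (2 + k)

    data Position : ℕ → Set where
      in-block : ∀ c q → c < 4 → q < m → Position (c + q * 4)
      in-tail  : ∀ c → c < r → Position (c + m * 4)

    position : ∀ j → j < n → Position j
    position j j<n with j % 4 | j / 4 | m%n<n j 4 | m≡m%n+[m/n]*n j 4
    ... | c | q | c<4 | refl with <-cmp q m
    ...   | tri< q<m _ _ = in-block c q c<4 q<m
    ...   | tri≈ _ q≡m _ = subst (λ q → Position (c + q * 4)) (sym q≡m)
                             (in-tail c (+-cancelʳ-< (m * 4) c r (subst₂ _<_ c+q*4≡ n≡r+m*4 j<n)))
      where
      c+q*4≡ : c + q * 4 ≡ c + m * 4
      c+q*4≡ = cong (λ q → c + q * 4) q≡m
    ...   | tri> _ _ m<q = ⊥-elim (<⇒≱ j<n (begin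
      n              ≡⟨ n≡r+m*4 ⟩
      r + m * 4      ≤⟨ +-monoˡ-≤ (m * 4) (≤-pred r<4) ⟩
      3 + m * 4      <⟨ ≤-refl ⟩
      suc m * 4      ≤⟨ *-monoˡ-≤ 4 m<q ⟩
      q * 4          ≤⟨ m≤n+m (q * 4) c ⟩
      c + q * 4      ∎))
      where open ≤-Reasoning

    shape : ∀ j → j < n → Shape j
    shape j j<n with position j j<n
    ... | in-block 0 q _ q<m = spoke-shape (spoke∈S q<m)
    ... | in-block 1 q _ q<m = inner-shape (inner∈S q<m) (vertex∈S q<m)
    ... | in-block 2 q _ q<m = vertex-shape (vertex∈S q<m) (proj₂ (next-spoke q<m))
    ... | in-block 3 q _ q<m = inner-end-shape (inner∈S q<m) (vertex∈S q<m) (proj₁ (next-spoke q<m))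
    ... | in-block (suc (suc (suc (suc _)))) _ c<4 _ = ⊥-elim (<⇒≱ c<4 (+-monoʳ-≤ 4 z≤n))
    ... | in-tail 0 0<r      = spoke-shape (tail-spoke∈S 0<r)
    ... | in-tail 1 1<r      = vertex-shape (tail-vertex₁∈S 1<r) (tail-inner₁-covered 1<r)
    ... | in-tail 2 2<r      = vertex-shape (tail-vertex₂∈S 2<r) (tail-inner₂-covered 2<r)
    ... | in-tail (suc (suc (suc _))) c<r = ⊥-elim (<⇒≱ r<4 (≤-trans (+-monoʳ-≤ 4 z≤n) c<r))

    V-dominated : ∀ {j} → Shape j → Covered S (V j) ⊎ ∃[ y ] (PAdj n 2 (V j) y × Chosen S y)
    V-dominated (spoke-shape s)               = inj₁ (covered-by s (inj₁ refl))
    V-dominated {j} (inner-shape _ w)         = inj₂ (_ , rim-adj j , chosen-by w)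
    V-dominated (vertex-shape w _)            = inj₁ (covered-by w refl)
    V-dominated (inner-end-shape {k} _ w _)   = inj₂ (_ , Sum.swap (rim-adj (1 + k)) , chosen-by w)

    U-dominated : ∀ {j} → Shape j → Covered S (U j) ⊎ ∃[ y ] (PAdj n 2 (U j) y × Chosen S y)
    U-dominated (spoke-shape s)               = inj₁ (covered-by s (inj₂ refl))
    U-dominated (inner-shape i _)             = inj₁ (covered-by i (inj₁ refl))
    U-dominated {j} (vertex-shape w _)        = inj₂ (_ , Sum.swap (spoke-adj j) , chosen-by w)
    U-dominated (inner-end-shape i _ _)       = inj₁ (covered-by i (inj₂ refl))

    rim-covered : ∀ {j} → Shape j → Covered S (V j) ⊎ Covered S (V (1 + j))
    rim-covered (spoke-shape s)               = inj₁ (covered-by s (inj₁ refl))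
    rim-covered (inner-shape _ w)             = inj₂ (covered-by w refl)
    rim-covered (vertex-shape w _)            = inj₁ (covered-by w refl)
    rim-covered (inner-end-shape _ _ c)       = inj₂ c

    spoke-covered : ∀ {j} → Shape j → Covered S (V j) ⊎ Covered S (U j)
    spoke-covered (spoke-shape s)             = inj₁ (covered-by s (inj₁ refl))
    spoke-covered (inner-shape i _)           = inj₂ (covered-by i (inj₁ refl))
    spoke-covered (vertex-shape w _)          = inj₁ (covered-by w refl)
    spoke-covered (inner-end-shape i _ _)     = inj₂ (covered-by i (inj₂ refl))

    inner-covered : ∀ {j} → Shape j → Covered S (U j) ⊎ Covered S (U (2 + j))
    inner-covered (spoke-shape s)             = inj₁ (covered-by s (inj₂ refl))
    inner-covered (inner-shape i _)           = inj₁ (covered-by i (inj₁ refl))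
    inner-covered (vertex-shape _ c)          = inj₂ c
    inner-covered (inner-end-shape i _ _)     = inj₁ (covered-by i (inj₂ refl))

    S-dominating : IsMixedDominating S
    S-dominating = covering⇒dominating edges-covered
      (Vtx-elim (λ j j<n → V-dominated (shape j j<n)) (λ j j<n → U-dominated (shape j j<n)))
      where
      pedge-covered : ∀ {a b} → PEdge n 2 a b → Covered S a ⊎ Covered S b
      pedge-covered = PEdge-elim {P = λ a b → Covered S a ⊎ Covered S b}
        (λ j j<n → rim-covered (shape j j<n)) (λ j j<n → spoke-covered (shape j j<n))
        (λ j j<n → inner-covered (shape j j<n))
      edges-covered : EdgesCovered S
      edges-covered (inj₁ e) = pedge-covered e
      edges-covered (inj₂ e) = Sum.swap (pedge-covered e)

theorem2 : ∀ (n : ℕ) .{{_ : NonZero n}} → 4 ≤ n →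
    MixedDomination.MixedDominationNumber (Vtx n) (PAdj n 2)
      (3 * (n / 4) + n % 4)
theorem2 n 4≤n = (S , S-dominating , length-S) , LowerBound.length-bound
  where
  open Petersen n (≤-trans (s≤s (s≤s z≤n)) 4≤n)
  0<n/4 : 0 < n / 4
  0<n/4 = n≢0⇒n>0 (λ n/4≡0 → <⇒≱ (m/n≡0⇒m<n n/4≡0) 4≤n)
  open Construction (n / 4) (n % 4) (m≡m%n+[m/n]*n n 4) (m%n<n n 4) 0<n/4
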